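{- Let $U_1,U_2,V_1,V_2$ be $\lambda H$-terms. If $U_1\rightarrow_t V_1$, $U_2\rightarrow_t V_2$ and $E(U_1)=E(U_2)$, then $E(V_1)=E(V_2)$.
   Context: $\lambda H$-terms are the $\lambda$-terms built from variables and one additional constant $H$ by abstraction and application. Application is left-associative. $U\rightarrow_t V$ means $V$ is obtained from $U$ by one head reduction step: $U=\lambda\overline{x}\,((\lambda x\,A)\,B)\,W_1\ldots W_n$ and $V=\lambda\overline{x}\,A[B/x]\,W_1\ldots W_n$. The map $E$ on $\lambda H$-terms is defined by induction: $E(x)=x$ for variables $x$; $E(H)=H$; $E(\lambda x\,U)=\lambda x\,E(U)$; $E(U\,V)=E(U)\,E(V)$ if $U$ is not of the form $H\,U_1\ldots U_n$ with $n\ge 0$; and $E(H\,U_1U_2\ldots U_n)=E(U_1U_2\ldots U_n)$ for $n\ge1$. -}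

module Defs where

open import Data.Nat using (ℕ; zero; suc; _<ᵇ_; _≡ᵇ_; pred; _+_)
open import Data.Bool using (if_then_else_)
open import Data.Maybe as Maybe using (Maybe; just; nothing)

-- λH-terms, with de Bruijn indices (so syntactic equality is α-equivalence)
data Term : Set where
  var : ℕ → Term
  H   : Term
  lam : Term → Term
  app : Term → Term → Term

lift : ℕ → Term → Term
lift c (var x)   = if x <ᵇ c then var x else var (suc x)
lift c H         = H
lift c (lam t)   = lam (lift (suc c) t)
lift c (app t u) = app (lift c t) (lift c u)

sub : ℕ → Term → Term → Term
sub j s (var x)   = if x <ᵇ j then var x else (if x ≡ᵇ j then s else var (pred x))
sub j s H         = H
sub j s (lam t)   = lam (sub (suc j) (lift 0 s) t)
sub j s (app t u) = app (sub j s t) (sub j s u)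

-- A [ B / x ]  where x is the variable bound by the λ of (λx A)
_[_/0] : Term → Term → Term
A [ B /0] = sub 0 B A

data _↦spine_ : Term → Term → Set where
  β    : ∀ {A B} → app (lam A) B ↦spine (A [ B /0])
  appL : ∀ {U V W} → U ↦spine V → app U W ↦spine app V W

-- head reduction:  λx̄ ((λx A) B) W₁ … Wₙ  →t  λx̄ A[B/x] W₁ … Wₙ
data _→t_ : Term → Term → Set where
  spine : ∀ {U V} → U ↦spine V → U →t V
  under : ∀ {U V} → U →t V → lam U →t lam V

-- The map E.
-- happ U V : if U = H U₁ … Uₖ (k ≥ 0) then  just (U₁ … Uₖ V)  (i.e. H U₁…Uₖ V with
-- the head H removed), otherwise nothing.
happ : Term → Term → Maybe Term
happ H         V = just V
happ (app U W) V = Maybe.map (λ t → app t V) (happ U W)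
happ (var x)   V = nothing
happ (lam t)   V = nothing

size : Term → ℕ
size (var x)   = 1
size H         = 1
size (lam t)   = suc (size t)
size (app t u) = suc (size t + size u)

-- E with a fuel argument; E t uses fuel size t, which is always sufficient
-- (every recursive call is on a term of strictly smaller size).
Ef : ℕ → Term → Term
Ef zero    t         = t
Ef (suc n) (var x)   = var x
Ef (suc n) H         = H
Ef (suc n) (lam U)   = lam (Ef n U)
Ef (suc n) (app U V) with happ U V
... | just W  = Ef n W                       -- E(H U₁ … Uₙ) = E(U₁ … Uₙ), n ≥ 1
... | nothing = app (Ef n U) (Ef n V)        -- E(U V) = E(U) E(V), U not of the form H U₁…Uₙ

E : Term → Term
E t = Ef (size t) t

-- E agrees with the structural map erase, in which an application whose erased
-- function is H collapses to its argument; in that form E commutes with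
-- substitution.  A head redex erases to an application, never to H or a λ, so
-- erasure preserves the head-redex structure, and two head reducts erase equally
-- as soon as their redexes do.

module Submission where

open import Defs
open import Relation.Binary.PropositionalEquality
  using (_≡_; _≢_; refl; sym; trans; cong; cong₂; module ≡-Reasoning)
open import Data.Nat using (zero; suc; _≤_; _<_; s≤s; _<ᵇ_; _≡ᵇ_)
open import Data.Nat.Properties using (≤-refl; ≤-trans; ≤-pred; m≤m+n; m≤n+m; +-monoˡ-≤)
open import Data.Bool using (true; false)
open import Data.Maybe using (just; nothing)
open import Data.Product using (∃₂; _×_; _,_)
open import Data.Empty using (⊥-elim)

infixl 7 _·_

_·_ : Term → Term → Term
H       · w = w
var x   · w = app (var x) w
lam t   · w = app (lam t) w
app t u · w = app (app t u) w

erase : Term → Term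
erase (var x)   = var x
erase H         = H
erase (lam t)   = lam (erase t)
erase (app t u) = erase t · erase u

app-injˡ : ∀ {a b c d} → app a b ≡ app c d → a ≡ c
app-injˡ refl = refl

app-injʳ : ∀ {a b c d} → app a b ≡ app c d → b ≡ d
app-injʳ refl = refl

lam-inj : ∀ {a b} → lam a ≡ lam b → a ≡ b
lam-inj refl = refl

erase-· : ∀ a b → erase (a · b) ≡ erase a · erase b
erase-· H       b = refl
erase-· (var x) b = refl
erase-· (lam t) b = refl
erase-· (app t u) b = refl

erase-idem : ∀ t → erase (erase t) ≡ erase t
erase-idem (var x)   = refl
erase-idem H         = refl
erase-idem (lam t)   = cong lam (erase-idem t)
erase-idem (app t u) = begin
  erase (erase t · erase u)         ≡⟨ erase-· (erase t) (erase u) ⟩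
  erase (erase t) · erase (erase u) ≡⟨ cong₂ _·_ (erase-idem t) (erase-idem u) ⟩
  erase t · erase u                 ∎
  where open ≡-Reasoning

lift-· : ∀ c a b → lift c (a · b) ≡ lift c a · lift c b
lift-· c H       b = refl
lift-· c (var x) b with x <ᵇ c
... | true  = refl
... | false = refl
lift-· c (lam t) b = refl
lift-· c (app t u) b = refl

erase-lift : ∀ c t → erase (lift c t) ≡ lift c (erase t)
erase-lift c (var x) with x <ᵇ c
... | true  = refl
... | false = refl
erase-lift c H         = refl
erase-lift c (lam t)   = cong lam (erase-lift (suc c) t)
erase-lift c (app t u) =
  trans (cong₂ _·_ (erase-lift c t) (erase-lift c u)) (sym (lift-· c (erase t) (erase u)))

erase-sub-erase-arg : ∀ j s t → erase (sub j s t) ≡ erase (sub j (erase s) t)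
erase-sub-erase-arg j s (var x) with x <ᵇ j
... | true = refl
... | false with x ≡ᵇ j
...   | true  = sym (erase-idem s)
...   | false = refl
erase-sub-erase-arg j s H         = refl
erase-sub-erase-arg j s (lam t)   = cong lam (begin
  erase (sub (suc j) (lift 0 s) t)          ≡⟨ erase-sub-erase-arg (suc j) (lift 0 s) t ⟩
  erase (sub (suc j) (erase (lift 0 s)) t)  ≡⟨ cong (λ s′ → erase (sub (suc j) s′ t)) (erase-lift 0 s) ⟩
  erase (sub (suc j) (lift 0 (erase s)) t)  ∎)
  where open ≡-Reasoning
erase-sub-erase-arg j s (app t u) =
  cong₂ _·_ (erase-sub-erase-arg j s t) (erase-sub-erase-arg j s u)

erase-sub-· : ∀ j s a b → erase (sub j s (a · b)) ≡ erase (sub j s a) · erase (sub j s b)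
erase-sub-· j s H       b = refl
erase-sub-· j s (var x) b = refl
erase-sub-· j s (lam t) b = refl
erase-sub-· j s (app t u) b = refl

erase-sub-erase-body : ∀ j s t → erase (sub j s t) ≡ erase (sub j s (erase t))
erase-sub-erase-body j s (var x)   = refl
erase-sub-erase-body j s H         = refl
erase-sub-erase-body j s (lam t)   = cong lam (erase-sub-erase-body (suc j) (lift 0 s) t)
erase-sub-erase-body j s (app t u) =
  trans (cong₂ _·_ (erase-sub-erase-body j s t) (erase-sub-erase-body j s u))
        (sym (erase-sub-· j s (erase t) (erase u)))

erase-[/0] : ∀ A B → erase (A [ B /0]) ≡ erase (erase A [ erase B /0])
erase-[/0] A B = trans (erase-sub-erase-arg 0 B A) (erase-sub-erase-body 0 (erase B) A)

erase-↦spine-app : ∀ {U V} → U ↦spine V → ∃₂ λ a b → erase U ≡ app a b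
erase-↦spine-app (β {A} {B}) = lam (erase A) , erase B , refl
erase-↦spine-app (appL {U} {W = W} p) with erase U | erase-↦spine-app p
... | .(app a b) | a , b , refl = app a b , erase W , refl

erase-↦spine-≢lam : ∀ {U V} → U ↦spine V → ∀ t → erase U ≢ lam t
erase-↦spine-≢lam p t e with erase-↦spine-app p
... | a , b , e′ with trans (sym e) e′
... | ()

erase-app-↦spine : ∀ {U V} W → U ↦spine V → erase (app U W) ≡ app (erase U) (erase W)
erase-app-↦spine {U} W p with erase U | erase-↦spine-app p
... | .(app a b) | a , b , refl = refl

↦spine-erase-det : ∀ {U₁ U₂ V₁ V₂} → U₁ ↦spine V₁ → U₂ ↦spine V₂ →
                   erase U₁ ≡ erase U₂ → erase V₁ ≡ erase V₂
↦spine-erase-det (β {A₁} {B₁}) (β {A₂} {B₂}) e = begin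
  erase (A₁ [ B₁ /0])             ≡⟨ erase-[/0] A₁ B₁ ⟩
  erase (erase A₁ [ erase B₁ /0]) ≡⟨ cong₂ (λ A B → erase (A [ B /0])) (lam-inj (app-injˡ e)) (app-injʳ e) ⟩
  erase (erase A₂ [ erase B₂ /0]) ≡⟨ erase-[/0] A₂ B₂ ⟨
  erase (A₂ [ B₂ /0])             ∎
  where open ≡-Reasoning
↦spine-erase-det (β {A₁}) (appL {W = W} p) e =
  ⊥-elim (erase-↦spine-≢lam p (erase A₁) (sym (app-injˡ (trans e (erase-app-↦spine W p)))))
↦spine-erase-det (appL {W = W} p) (β {A₂}) e =
  ⊥-elim (erase-↦spine-≢lam p (erase A₂) (sym (app-injˡ (trans (sym e) (erase-app-↦spine W p)))))
↦spine-erase-det (appL {W = W₁} p₁) (appL {W = W₂} p₂) e =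
  cong₂ _·_ (↦spine-erase-det p₁ p₂ (app-injˡ e′)) (app-injʳ e′)
  where e′ = trans (sym (erase-app-↦spine W₁ p₁)) (trans e (erase-app-↦spine W₂ p₂))

→t-erase-det : ∀ {U₁ U₂ V₁ V₂} → U₁ →t V₁ → U₂ →t V₂ → erase U₁ ≡ erase U₂ → erase V₁ ≡ erase V₂
→t-erase-det (spine p) (spine q) e = ↦spine-erase-det p q e
→t-erase-det (spine p) (under {U} q) e = ⊥-elim (erase-↦spine-≢lam p (erase U) e)
→t-erase-det (under {U} p) (spine q) e = ⊥-elim (erase-↦spine-≢lam q (erase U) (sym e))
→t-erase-det (under p) (under q) e = cong lam (→t-erase-det p q (lam-inj e))

happ-just : ∀ U V {W} → happ U V ≡ just W → erase (app U V) ≡ erase W × size W < size (app U V)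
happ-just H V refl = refl , s≤s (m≤n+m (size V) 1)
happ-just (app U X) V e with happ U X in eq
happ-just (app U X) V refl | just T with happ-just U X eq
... | erase≡ , size< = cong (_· erase V) erase≡ , s≤s (+-monoˡ-≤ (size V) size<)

happ-nothing : ∀ U V → happ U V ≡ nothing → erase (app U V) ≡ app (erase U) (erase V)
happ-nothing (var x) V e = refl
happ-nothing (lam t) V e = refl
happ-nothing (app U X) V e with happ U X in eq
happ-nothing (app U X) V () | just T
... | nothing rewrite happ-nothing U X eq = refl

Ef≡erase : ∀ n t → size t ≤ n → Ef n t ≡ erase t
Ef≡erase zero    (var x)   ()
Ef≡erase zero    H         ()
Ef≡erase zero    (lam t)   ()
Ef≡erase zero    (app t u) ()
Ef≡erase (suc n) (var x)   _        = refl
Ef≡erase (suc n) H         _        = refl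
Ef≡erase (suc n) (lam t)   (s≤s le) = cong lam (Ef≡erase n t le)
Ef≡erase (suc n) (app U V) (s≤s le) with happ U V in eq
... | just W with happ-just U V eq
...   | erase≡ , size< = trans (Ef≡erase n W (≤-pred (≤-trans size< (s≤s le)))) (sym erase≡)
Ef≡erase (suc n) (app U V) (s≤s le) | nothing =
  trans (cong₂ app (Ef≡erase n U (≤-trans (m≤m+n _ _) le)) (Ef≡erase n V (≤-trans (m≤n+m _ _) le)))
        (sym (happ-nothing U V eq))

E≡erase : ∀ t → E t ≡ erase t
E≡erase t = Ef≡erase (size t) t ≤-refl

lemma3p6 : (U₁ U₂ V₁ V₂ : Term) → U₁ →t V₁ → U₂ →t V₂ → E U₁ ≡ E U₂ → E V₁ ≡ E V₂
lemma3p6 U₁ U₂ V₁ V₂ p q e = begin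
  E V₁     ≡⟨ E≡erase V₁ ⟩
  erase V₁ ≡⟨ →t-erase-det p q (trans (sym (E≡erase U₁)) (trans e (E≡erase U₂))) ⟩
  erase V₂ ≡⟨ E≡erase V₂ ⟨
  E V₂     ∎
  where open ≡-Reasoning
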